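{- Letting each elementary transposition $s_i=(i,i+1)$ act on $a=(a_1,a_2,\dots)\in E$ by swapping $a_i$ and $a_{i+1}$ if one of them is zero, and fixing $a$ otherwise, defines an action of $\mathfrak{S}_\infty$ on $E$.
   Context: $E$ is the set of infinite sequences $a=(a_1,a_2,\dots)$ of nonnegative integers with finitely many nonzero entries such that the subword $a_{j_1}\dots a_{j_k}$ ($j_1<\dots<j_k$) of nonzero entries is a permutation of $[k]$. $\mathfrak{S}_\infty$ is the infinite symmetric group, generated by the elementary transpositions $s_i=(i,i+1)$, $i\ge1$, subject to the Coxeter relations. -}

module Defs where

open import Data.Nat using (ℕ; zero; suc; _≤_; _≟_)
open import Data.Bool using (Bool; true; false; if_then_else_; _∨_)
open import Data.List using (List; map; filter; upTo)
open import Data.Product using (Σ; _×_)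
open import Relation.Nullary using (¬_; does)
open import Relation.Nullary.Decidable using (¬?)
open import Relation.Binary.PropositionalEquality using (_≡_)
open import Data.List.Relation.Binary.Permutation.Propositional using (_↭_)

-- Sequences a = (a_1, a_2, ...) are modelled as functions ℕ → ℕ with
-- 0-based positions: the paper's a_{j+1} is (a j).
Seq : Set
Seq = ℕ → ℕ

VanishesFrom : Seq → ℕ → Set
VanishesFrom a N = ∀ j → N ≤ j → a j ≡ 0

nonzeroSubword : Seq → ℕ → List ℕ
nonzeroSubword a N = filter (λ x → ¬? (x ≟ 0)) (map a (upTo N))

range1 : ℕ → List ℕ
range1 k = map suc (upTo k)

InE : Seq → Set
InE a = Σ ℕ λ N → Σ ℕ λ k → VanishesFrom a N × (nonzeroSubword a N ↭ range1 k)

swap : ℕ → Seq → Seq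
swap i a j =
  if does (j ≟ i) then a (suc i)
  else if does (j ≟ suc i) then a i
  else a j

-- action of s_{i+1} (0-based i): swap a_i, a_{i+1} if one of them is zero
act : ℕ → Seq → Seq
act i a = if (does (a i ≟ 0) ∨ does (a (suc i) ≟ 0)) then swap i a else a

_≗ˢ_ : Seq → Seq → Set
a ≗ˢ b = ∀ j → a j ≡ b j

{-# OPTIONS --safe #-}
-- The generator s_i only touches positions i and i+1, where it replaces the
-- pair (a_i, a_{i+1}) by exchange (a_i, a_{i+1}).  Hence the Coxeter relations
-- reduce to identities of exchange on pairs and triples, which only depend on
-- the zero/nonzero pattern of the entries; they hold for all sequences, not
-- just those in E.  Membership in E is preserved because exchange only moves a
-- letter past a zero, so the nonzero subword does not change at all.
module Submission where

open import Defs
open import Data.Bool using (Bool; if_then_else_; _∨_)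
open import Data.Bool.Properties using (if-float; if-eta)
open import Data.List using (List; []; _++_; [_]; map; filter; upTo)
open import Data.List.Properties using (upTo-∷ʳ; map-++; filter-++; ++-assoc; ++-identityʳ)
open import Data.List.Relation.Binary.Permutation.Propositional using (_↭_)
open import Data.Nat using (ℕ; zero; suc; _+_; _<_; _≤′_; ≤′-refl; ≤′-step; _≟_; _<?_)
open import Data.Nat.Properties
  using (1+n≢n; <⇒≢; >⇒≢; n<1+n; m<n⇒m<1+n; <-trans; <-≤-trans; ≤-trans; ≮⇒≥; m≤m+n; m≤n+m; ≤⇒≤′; ≤′⇒≤)
open import Data.Product using (_×_; _,_; proj₁; proj₂)
open import Function using (_∘_)
open import Relation.Nullary using (yes; no; does; ¬?; contradiction)
open import Relation.Nullary.Decidable using (dec-true; dec-false)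
open import Relation.Binary.PropositionalEquality
  using (_≡_; _≢_; refl; sym; trans; cong; cong₂; subst; module ≡-Reasoning)

open ≡-Reasoning

exchange : ℕ × ℕ → ℕ × ℕ
exchange (x , y) = if does (x ≟ 0) ∨ does (y ≟ 0) then (y , x) else (x , y)

exchange-involutive : ∀ p → exchange (exchange p) ≡ p
exchange-involutive (zero  , zero)  = refl
exchange-involutive (zero  , suc y) = refl
exchange-involutive (suc x , zero)  = refl
exchange-involutive (suc x , suc y) = refl

exchangeˡ : ℕ × ℕ × ℕ → ℕ × ℕ × ℕ
exchangeˡ (x , y , z) = proj₁ (exchange (x , y)) , proj₂ (exchange (x , y)) , z

exchangeʳ : ℕ × ℕ × ℕ → ℕ × ℕ × ℕ
exchangeʳ (x , yz) = x , exchange yz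

exchange-braid : ∀ t → exchangeˡ (exchangeʳ (exchangeˡ t)) ≡ exchangeʳ (exchangeˡ (exchangeʳ t))
exchange-braid (zero  , zero  , zero)  = refl
exchange-braid (zero  , zero  , suc z) = refl
exchange-braid (zero  , suc y , zero)  = refl
exchange-braid (zero  , suc y , suc z) = refl
exchange-braid (suc x , zero  , zero)  = refl
exchange-braid (suc x , zero  , suc z) = refl
exchange-braid (suc x , suc y , zero)  = refl
exchange-braid (suc x , suc y , suc z) = refl

keepNonzero : List ℕ → List ℕ
keepNonzero = filter (λ x → ¬? (x ≟ 0))

keepNonzero-exchange : ∀ p →
  keepNonzero [ proj₁ (exchange p) ] ++ keepNonzero [ proj₂ (exchange p) ]
    ≡ keepNonzero [ proj₁ p ] ++ keepNonzero [ proj₂ p ]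
keepNonzero-exchange (zero  , zero)  = refl
keepNonzero-exchange (zero  , suc y) = refl
keepNonzero-exchange (suc x , zero)  = refl
keepNonzero-exchange (suc x , suc y) = refl

window : ℕ → Seq → ℕ × ℕ
window i a = a i , a (suc i)

window₃ : ℕ → Seq → ℕ × ℕ × ℕ
window₃ i a = a i , a (suc i) , a (suc (suc i))

data Position (i : ℕ) : ℕ → Set where
  left    : Position i i
  right   : Position i (suc i)
  outside : ∀ {j} → j ≢ i → j ≢ suc i → Position i j

position : ∀ i j → Position i j
position i j with j ≟ i | j ≟ suc i
... | yes refl | _        = left
... | no _     | yes refl = right
... | no j≢i   | no j≢1+i = outside j≢i j≢1+i

swap-window : ∀ i a → window i (swap i a) ≡ (a (suc i) , a i)
swap-window i a
  rewrite dec-true (i ≟ i) refl | dec-false (suc i ≟ i) 1+n≢n = refl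

swap-outside : ∀ i a {j} → j ≢ i → j ≢ suc i → swap i a j ≡ a j
swap-outside i a {j} j≢i j≢1+i rewrite dec-false (j ≟ i) j≢i | dec-false (j ≟ suc i) j≢1+i = refl

act-window : ∀ i a → window i (act i a) ≡ exchange (window i a)
act-window i a = begin
  window i (act i a)                                    ≡⟨ if-float (window i) c {swap i a} {a} ⟩
  (if c then window i (swap i a) else window i a)       ≡⟨ cong (λ w → if c then w else window i a) (swap-window i a) ⟩
  exchange (window i a)                                 ∎
  where
  c : Bool
  c = does (a i ≟ 0) ∨ does (a (suc i) ≟ 0)

act-outside : ∀ i a {j} → j ≢ i → j ≢ suc i → act i a j ≡ a j
act-outside i a {j} j≢i j≢1+i = begin
  act i a j                          ≡⟨ if-float (λ b → b j) c {swap i a} {a} ⟩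
  (if c then swap i a j else a j)    ≡⟨ cong (λ x → if c then x else a j) (swap-outside i a j≢i j≢1+i) ⟩
  (if c then a j else a j)           ≡⟨ if-eta c ⟩
  a j                                ∎
  where
  c : Bool
  c = does (a i ≟ 0) ∨ does (a (suc i) ≟ 0)

act-below : ∀ i a {j} → j < i → act i a j ≡ a j
act-below i a j<i = act-outside i a (<⇒≢ j<i) (<⇒≢ (m<n⇒m<1+n j<i))

act-above : ∀ i a {j} → suc i < j → act i a j ≡ a j
act-above i a 1+i<j = act-outside i a (>⇒≢ (<-trans (n<1+n i) 1+i<j)) (>⇒≢ 1+i<j)

act-window-cong : ∀ i {a b} → window i a ≡ window i b → window i (act i a) ≡ window i (act i b)
act-window-cong i {a} {b} eq = begin
  window i (act i a)     ≡⟨ act-window i a ⟩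
  exchange (window i a)  ≡⟨ cong exchange eq ⟩
  exchange (window i b)  ≡⟨ sym (act-window i b) ⟩
  window i (act i b)     ∎

act-local : ∀ i {a b} j → window i a ≡ window i b → a j ≡ b j → act i a j ≡ act i b j
act-local i {a} {b} j w eq with position i j
... | left        = cong proj₁ (act-window-cong i {a} {b} w)
... | right       = cong proj₂ (act-window-cong i {a} {b} w)
... | outside p q = trans (act-outside i a p q) (trans eq (sym (act-outside i b p q)))

window-act-act : ∀ i a → window i (act i (act i a)) ≡ window i a
window-act-act i a = begin
  window i (act i (act i a))         ≡⟨ act-window i (act i a) ⟩
  exchange (window i (act i a))      ≡⟨ cong exchange (act-window i a) ⟩
  exchange (exchange (window i a))   ≡⟨ exchange-involutive (window i a) ⟩
  window i a                         ∎

act-involutive : ∀ i a → act i (act i a) ≗ˢ a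
act-involutive i a j with position i j
... | left        = cong proj₁ (window-act-act i a)
... | right       = cong proj₂ (window-act-act i a)
... | outside p q = trans (act-outside i (act i a) p q) (act-outside i a p q)

act-comm-far : ∀ i k a → suc i < k → act i (act k a) ≗ˢ act k (act i a)
act-comm-far i k a 1+i<k j with j <? k
... | yes j<k = begin
  act i (act k a) j    ≡⟨ act-local i j (cong₂ _,_ (act-below k a i<k) (act-below k a 1+i<k)) (act-below k a j<k) ⟩
  act i a j            ≡⟨ sym (act-below k (act i a) j<k) ⟩
  act k (act i a) j    ∎
  where
  i<k : i < k
  i<k = <-trans (n<1+n i) 1+i<k
... | no j≮k = begin
  act i (act k a) j    ≡⟨ act-above i (act k a) 1+i<j ⟩
  act k a j            ≡⟨ sym (act-local k j (cong₂ _,_ (act-above i a 1+i<k) (act-above i a (m<n⇒m<1+n 1+i<k)))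
                                              (act-above i a 1+i<j)) ⟩
  act k (act i a) j    ∎
  where
  1+i<j : suc i < j
  1+i<j = <-≤-trans 1+i<k (≮⇒≥ j≮k)

window₃-act : ∀ i a → window₃ i (act i a) ≡ exchangeˡ (window₃ i a)
window₃-act i a =
  cong₂ (λ p z → proj₁ p , proj₂ p , z) (act-window i a) (act-above i a (n<1+n (suc i)))

window₃-act-suc : ∀ i a → window₃ i (act (suc i) a) ≡ exchangeʳ (window₃ i a)
window₃-act-suc i a = cong₂ _,_ (act-below (suc i) a (n<1+n i)) (act-window (suc i) a)

window₃-braid : ∀ i a →
  window₃ i (act i (act (suc i) (act i a))) ≡ window₃ i (act (suc i) (act i (act (suc i) a)))
window₃-braid i a = begin
  window₃ i (act i (act (suc i) (act i a)))          ≡⟨ window₃-act i (act (suc i) (act i a)) ⟩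
  exchangeˡ (window₃ i (act (suc i) (act i a)))      ≡⟨ cong exchangeˡ (window₃-act-suc i (act i a)) ⟩
  exchangeˡ (exchangeʳ (window₃ i (act i a)))        ≡⟨ cong (exchangeˡ ∘ exchangeʳ) (window₃-act i a) ⟩
  exchangeˡ (exchangeʳ (exchangeˡ (window₃ i a)))    ≡⟨ exchange-braid (window₃ i a) ⟩
  exchangeʳ (exchangeˡ (exchangeʳ (window₃ i a)))    ≡⟨ cong (exchangeʳ ∘ exchangeˡ) (window₃-act-suc i a) ⟨
  exchangeʳ (exchangeˡ (window₃ i (act (suc i) a)))  ≡⟨ cong exchangeʳ (window₃-act i (act (suc i) a)) ⟨
  exchangeʳ (window₃ i (act i (act (suc i) a)))      ≡⟨ window₃-act-suc i (act i (act (suc i) a)) ⟨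
  window₃ i (act (suc i) (act i (act (suc i) a)))    ∎

act-braid : ∀ i a → act i (act (suc i) (act i a)) ≗ˢ act (suc i) (act i (act (suc i) a))
act-braid i a j with position i j
... | left  = cong proj₁ (window₃-braid i a)
... | right = cong (proj₁ ∘ proj₂) (window₃-braid i a)
... | outside j≢i j≢1+i with position (suc i) j
...   | left          = contradiction refl j≢1+i
...   | right         = cong (proj₂ ∘ proj₂) (window₃-braid i a)
...   | outside _ j≢2+i = begin
  act i (act (suc i) (act i a)) j    ≡⟨ act-outside i (act (suc i) (act i a)) j≢i j≢1+i ⟩
  act (suc i) (act i a) j            ≡⟨ act-outside (suc i) (act i a) j≢1+i j≢2+i ⟩
  act i a j                          ≡⟨ act-outside i a j≢i j≢1+i ⟩
  a j                                ≡⟨ act-outside (suc i) a j≢1+i j≢2+i ⟨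
  act (suc i) a j                    ≡⟨ act-outside i (act (suc i) a) j≢i j≢1+i ⟨
  act i (act (suc i) a) j            ≡⟨ act-outside (suc i) (act i (act (suc i) a)) j≢1+i j≢2+i ⟨
  act (suc i) (act i (act (suc i) a)) j ∎

nonzeroSubword-suc : ∀ a n → nonzeroSubword a (suc n) ≡ nonzeroSubword a n ++ keepNonzero [ a n ]
nonzeroSubword-suc a n = begin
  keepNonzero (map a (upTo (suc n)))         ≡⟨ cong (keepNonzero ∘ map a) (upTo-∷ʳ n) ⟨
  keepNonzero (map a (upTo n ++ [ n ]))      ≡⟨ cong keepNonzero (map-++ a (upTo n) [ n ]) ⟩
  keepNonzero (map a (upTo n) ++ [ a n ])    ≡⟨ filter-++ (λ x → ¬? (x ≟ 0)) (map a (upTo n)) [ a n ] ⟩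
  nonzeroSubword a n ++ keepNonzero [ a n ]  ∎

nonzeroSubword-suc² : ∀ a n →
  nonzeroSubword a (suc (suc n)) ≡ nonzeroSubword a n ++ keepNonzero [ a n ] ++ keepNonzero [ a (suc n) ]
nonzeroSubword-suc² a n = begin
  nonzeroSubword a (suc (suc n))                                            ≡⟨ nonzeroSubword-suc a (suc n) ⟩
  nonzeroSubword a (suc n) ++ keepNonzero [ a (suc n) ]                     ≡⟨ cong (_++ keepNonzero [ a (suc n) ])
                                                                                    (nonzeroSubword-suc a n) ⟩
  (nonzeroSubword a n ++ keepNonzero [ a n ]) ++ keepNonzero [ a (suc n) ]  ≡⟨ ++-assoc (nonzeroSubword a n) _ _ ⟩
  nonzeroSubword a n ++ keepNonzero [ a n ] ++ keepNonzero [ a (suc n) ]    ∎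

nonzeroSubword-cong : ∀ {a b} n → (∀ {j} → j < n → a j ≡ b j) → nonzeroSubword a n ≡ nonzeroSubword b n
nonzeroSubword-cong zero eq = refl
nonzeroSubword-cong {a} {b} (suc n) eq = begin
  nonzeroSubword a (suc n)                   ≡⟨ nonzeroSubword-suc a n ⟩
  nonzeroSubword a n ++ keepNonzero [ a n ]  ≡⟨ cong₂ (λ l x → l ++ keepNonzero [ x ])
                                                      (nonzeroSubword-cong n (eq ∘ m<n⇒m<1+n)) (eq (n<1+n n)) ⟩
  nonzeroSubword b n ++ keepNonzero [ b n ]  ≡⟨ nonzeroSubword-suc b n ⟨
  nonzeroSubword b (suc n)                   ∎

nonzeroSubword-vanishing : ∀ {a N M} → VanishesFrom a N → N ≤′ M → nonzeroSubword a M ≡ nonzeroSubword a N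
nonzeroSubword-vanishing v ≤′-refl = refl
nonzeroSubword-vanishing {a} {N} v (≤′-step {M} N≤′M) = begin
  nonzeroSubword a (suc M)                   ≡⟨ nonzeroSubword-suc a M ⟩
  nonzeroSubword a M ++ keepNonzero [ a M ]  ≡⟨ cong (λ x → nonzeroSubword a M ++ keepNonzero [ x ]) (v M (≤′⇒≤ N≤′M)) ⟩
  nonzeroSubword a M ++ []                   ≡⟨ ++-identityʳ _ ⟩
  nonzeroSubword a M                         ≡⟨ nonzeroSubword-vanishing v N≤′M ⟩
  nonzeroSubword a N                         ∎

nonzeroSubword-act : ∀ i a {M} → suc (suc i) ≤′ M → nonzeroSubword (act i a) M ≡ nonzeroSubword a M
nonzeroSubword-act i a ≤′-refl = begin
  nonzeroSubword (act i a) (suc (suc i))                       ≡⟨ nonzeroSubword-suc² (act i a) i ⟩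
  nonzeroSubword (act i a) i ++ keepNonzero [ act i a i ] ++ keepNonzero [ act i a (suc i) ]
    ≡⟨ cong₂ (λ l p → l ++ keepNonzero [ proj₁ p ] ++ keepNonzero [ proj₂ p ])
             (nonzeroSubword-cong i (act-below i a)) (act-window i a) ⟩
  nonzeroSubword a i ++ keepNonzero [ proj₁ (exchange (window i a)) ] ++ keepNonzero [ proj₂ (exchange (window i a)) ]
    ≡⟨ cong (nonzeroSubword a i ++_) (keepNonzero-exchange (window i a)) ⟩
  nonzeroSubword a i ++ keepNonzero [ a i ] ++ keepNonzero [ a (suc i) ]  ≡⟨ nonzeroSubword-suc² a i ⟨
  nonzeroSubword a (suc (suc i))                                          ∎
nonzeroSubword-act i a (≤′-step {M} 2+i≤′M) = begin
  nonzeroSubword (act i a) (suc M)                   ≡⟨ nonzeroSubword-suc (act i a) M ⟩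
  nonzeroSubword (act i a) M ++ keepNonzero [ act i a M ]
    ≡⟨ cong₂ (λ l x → l ++ keepNonzero [ x ]) (nonzeroSubword-act i a 2+i≤′M) (act-above i a (≤′⇒≤ 2+i≤′M)) ⟩
  nonzeroSubword a M ++ keepNonzero [ a M ]          ≡⟨ nonzeroSubword-suc a M ⟨
  nonzeroSubword a (suc M)                           ∎

act-preserves-E : ∀ i a → InE a → InE (act i a)
act-preserves-E i a (N , k , a-vanishes , a-perm) =
  M , k , act-vanishes , subst (_↭ range1 k) (sym same-subword) a-perm
  where
  M : ℕ
  M = N + suc (suc i)
  act-vanishes : VanishesFrom (act i a) M
  act-vanishes j M≤j =
    trans (act-above i a (≤-trans (m≤n+m _ N) M≤j)) (a-vanishes j (≤-trans (m≤m+n N _) M≤j))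
  same-subword : nonzeroSubword (act i a) M ≡ nonzeroSubword a N
  same-subword = trans (nonzeroSubword-act i a (≤⇒≤′ (m≤n+m _ N)))
                       (nonzeroSubword-vanishing a-vanishes (≤⇒≤′ (m≤m+n N _)))

mainTheorem5 :
    (∀ i a → InE a → InE (act i a))
    × (∀ i a → InE a → act i (act i a) ≗ˢ a)
    × (∀ i k a → InE a → suc i < k → act i (act k a) ≗ˢ act k (act i a))
    × (∀ i a → InE a → act i (act (suc i) (act i a)) ≗ˢ act (suc i) (act i (act (suc i) a)))
mainTheorem5 =
    act-preserves-E
  , (λ i a _ → act-involutive i a)
  , (λ i k a _ → act-comm-far i k a)
  , (λ i a _ → act-braid i a)
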